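{- Let $n \geq 5$ be an odd integer. Then Player $B$ has a winning strategy in the game $Z(n,d)$ for every integer $d$ with $\frac{n+3}{2} \leq d \leq n-1$.
   Context: For integers $n \geq 4$ and $d \geq 2$, $Z(n,d)$ is the following two-player game. Initially the board contains the numbers $1,2,\dots,n$. Players $A$ and $B$ alternately cross out (remove) one number from the board, with $A$ moving first, until exactly two numbers remain. If the sum of the two remaining numbers is divisible by $d$, $A$ wins; otherwise $B$ wins. A player has a winning strategy if that player can force a win regardless of the opponent's moves. -}

module Defs where

open import Data.Nat using (ℕ; zero; suc; _+_)
open import Data.Nat.Divisibility using (_∣_)
open import Data.Fin using (Fin; toℕ)
open import Data.Vec using (Vec; []; _∷_; removeAt; tabulate)
open import Data.Product using (Σ)
open import Data.Empty using (⊥)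
open import Relation.Nullary using (¬_)

data Player : Set where
  A B : Player

-- BWins d p k board : with k moves remaining, player p to move, and the
-- board (k + 2 numbers, as a vector), player B can force that the sum of
-- the two final numbers is NOT divisible by d.
BWins : (d : ℕ) → Player → (k : ℕ) → Vec ℕ (k + 2) → Set
BWins d p zero (x ∷ y ∷ []) = ¬ (d ∣ x + y)
BWins d A (suc k) v = (i : Fin (suc (k + 2))) → BWins d B k (removeAt v i)
BWins d B (suc k) v = Σ (Fin (suc (k + 2))) λ i → BWins d A k (removeAt v i)

initialBoard : (n : ℕ) → Vec ℕ n
initialBoard n = tabulate (λ i → suc (toℕ i))

-- Player B has a winning strategy in Z(n,d) (A moves first).
-- For n < 2 the game is not defined; we set it to ⊥ (irrelevant: n ≥ 4).
BHasWinningStrategy : (n d : ℕ) → Set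
BHasWinningStrategy zero d = ⊥
BHasWinningStrategy (suc zero) d = ⊥
BHasWinningStrategy (suc (suc k)) d = BWins d A k (initialBoard (k + 2))

-- B crosses out, on each of her turns, a "blocker" while one is left.  Since
-- n + 3 ≤ 2d, a pair x < y ≤ n with d ∣ x + y sums to d, 2d or 3d, so every such
-- pair contains a blocker: a number strictly between d/2 and d, a number above
-- 3d/2, or d/2 itself when its partner 3d/2 is on the board.  There are at most
-- n − d blockers, and at most ⌈d/2⌉ − 1 when 3d/2 > n; both are at most
-- ⌊(n − 2)/2⌋, the number of turns of B, so the final pair contains no blocker.
module Submission where

open import Defs
open import Level using (Level; 0ℓ)
open import Data.Nat using (ℕ; zero; suc; _+_; _*_; _∸_; _%_; _≤_; _<_; z≤n; s≤s; pred; ⌊_/2⌋; ⌈_/2⌉; _≟_; _≤?_; _<?_)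
open import Data.Nat.Properties
open import Data.Nat.Divisibility using (_∣_; divides)
open import Data.Nat.Tactic.RingSolver using (solve-∀)
open import Data.Fin as Fin using (Fin; zero; suc; toℕ)
open import Data.Fin.Properties using (toℕ<n)
open import Data.Vec using (Vec; []; _∷_; removeAt; tabulate; count)
open import Data.Vec.Relation.Unary.All as All using (All; []; _∷_)
import Data.Vec.Relation.Unary.All.Properties as Allₚ
open import Data.Vec.Relation.Unary.AllPairs using (AllPairs; []; _∷_)
open import Data.Product using (∃; _×_; _,_; proj₂)
open import Data.Sum using (_⊎_; inj₁; inj₂)
open import Data.Empty using (⊥-elim)
open import Function using (_∘_)
open import Relation.Nullary using (¬_; yes; no)
open import Relation.Nullary.Decidable using (_×-dec_; _⊎-dec_)
open import Relation.Unary using (Pred; Decidable; _∪_)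
open import Relation.Unary.Properties using (_∪?_)
open import Relation.Binary using (Rel; tri<; tri≈; tri>)
open import Relation.Binary.PropositionalEquality using (_≡_; refl; sym; trans; cong; cong₂; subst; module ≡-Reasoning)

private
  variable
    a p q r : Level
    X : Set a
    n : ℕ

All-removeAt : {P : Pred X p} (xs : Vec X (suc n)) (i : Fin (suc n)) →
               All P xs → All P (removeAt xs i)
All-removeAt (x ∷ xs)     zero    (px ∷ pxs) = pxs
All-removeAt (x ∷ y ∷ xs) (suc i) (px ∷ pxs) = px ∷ All-removeAt (y ∷ xs) i pxs

AllPairs-removeAt : {R : Rel X r} (xs : Vec X (suc n)) (i : Fin (suc n)) →
                    AllPairs R xs → AllPairs R (removeAt xs i)
AllPairs-removeAt (x ∷ xs)     zero    (_ ∷ rxs)   = rxs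
AllPairs-removeAt (x ∷ y ∷ xs) (suc i) (rx ∷ rxs) =
  All-removeAt (y ∷ xs) i rx ∷ AllPairs-removeAt (y ∷ xs) i rxs

AllPairs-tabulate-< : {f : Fin n → ℕ} → (∀ {i j} → i Fin.< j → f i < f j) →
                      AllPairs _<_ (tabulate f)
AllPairs-tabulate-< {zero}  f-mono = []
AllPairs-tabulate-< {suc n} f-mono =
  Allₚ.tabulate⁺ (λ j → f-mono (s≤s z≤n)) ∷ AllPairs-tabulate-< (f-mono ∘ s≤s)

module _ {P : Pred X p} (P? : Decidable P) where

  count-removeAt-≤ : (xs : Vec X (suc n)) (i : Fin (suc n)) →
                     count P? (removeAt xs i) ≤ count P? xs
  count-removeAt-≤ (x ∷ xs) zero with P? x
  ... | yes _ = n≤1+n _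
  ... | no  _ = ≤-refl
  count-removeAt-≤ (x ∷ y ∷ xs) (suc i) with P? x
  ... | yes _ = s≤s (count-removeAt-≤ (y ∷ xs) i)
  ... | no  _ = count-removeAt-≤ (y ∷ xs) i

  ∃removeAt-count≡pred : (xs : Vec X (suc n)) →
                         ∃ λ i → count P? (removeAt xs i) ≡ pred (count P? xs)
  ∃removeAt-count≡pred (x ∷ xs) with P? x
  ... | yes _ = zero , refl
  ∃removeAt-count≡pred (x ∷ [])     | no _ = zero , refl
  ∃removeAt-count≡pred (x ∷ y ∷ xs) | no ¬px with ∃removeAt-count≡pred (y ∷ xs)
  ... | i , eq = suc i , eq′
    where
    eq′ : count P? (x ∷ removeAt (y ∷ xs) i) ≡ pred (count P? (y ∷ xs))
    eq′ with P? x
    ... | yes px = ⊥-elim (¬px px)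
    ... | no  _  = eq

  count≡0⇒All¬ : (xs : Vec X n) → count P? xs ≡ 0 → All (¬_ ∘ P) xs
  count≡0⇒All¬ []       _  = []
  count≡0⇒All¬ (x ∷ xs) eq with P? x
  ... | no ¬px = ¬px ∷ count≡0⇒All¬ xs eq

  All¬⇒count≡0 : (xs : Vec X n) → All (¬_ ∘ P) xs → count P? xs ≡ 0
  All¬⇒count≡0 []       []           = refl
  All¬⇒count≡0 (x ∷ xs) (¬px ∷ ¬pxs) with P? x
  ... | yes px = ⊥-elim (¬px px)
  ... | no  _  = All¬⇒count≡0 xs ¬pxs

count-∪-≤ : {P : Pred X p} {Q : Pred X q} (P? : Decidable P) (Q? : Decidable Q) (xs : Vec X n) →
            count (P? ∪? Q?) xs ≤ count P? xs + count Q? xs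
count-∪-≤ P? Q? []       = z≤n
count-∪-≤ P? Q? (x ∷ xs) with P? x | Q? x
... | yes _ | yes _ = s≤s (≤-trans (count-∪-≤ P? Q? xs) (≤-trans (n≤1+n _) (≤-reflexive (sym (+-suc _ _)))))
... | yes _ | no  _ = s≤s (count-∪-≤ P? Q? xs)
... | no  _ | yes _ = ≤-trans (s≤s (count-∪-≤ P? Q? xs)) (≤-reflexive (sym (+-suc _ _)))
... | no  _ | no  _ = count-∪-≤ P? Q? xs

module _ {P : Pred ℕ p} (P? : Decidable P) where

  count≤hi∸lo : ∀ {lo hi} (xs : Vec ℕ n) → AllPairs _<_ xs →
                All (λ x → P x → lo ≤ x × x < hi) xs → count P? xs ≤ hi ∸ lo
  count≤hi∸lo []       _               []         = z≤n
  count≤hi∸lo (x ∷ xs) (x<xs ∷ sorted) (bx ∷ bxs) with P? x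
  ... | no  _  = count≤hi∸lo xs sorted bxs
  count≤hi∸lo {lo = lo} {hi = hi} (x ∷ xs) (x<xs ∷ sorted) (bx ∷ bxs) | yes px with bx px
  ... | lo≤x , x<hi = begin
    suc (count P? xs) ≤⟨ s≤s (count≤hi∸lo xs sorted (All.map above-x (All.zip (x<xs , bxs)))) ⟩
    suc (hi ∸ suc x)  ≡⟨ sym (+-∸-assoc 1 x<hi) ⟩
    hi ∸ x            ≤⟨ ∸-monoʳ-≤ hi lo≤x ⟩
    hi ∸ lo           ∎
    where
    open ≤-Reasoning
    above-x : ∀ {y} → x < y × (P y → lo ≤ y × y < hi) → P y → suc x ≤ y × y < hi
    above-x (x<y , by) py = x<y , proj₂ (by py)

turnsLeftForB : Player → ℕ → ℕ
turnsLeftForB A k = ⌊ k /2⌋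
turnsLeftForB B k = ⌈ k /2⌉

module _ (d : ℕ) {Q : Pred ℕ q} {R : Rel ℕ r} {C : Pred ℕ p} (C? : Decidable C)
         (C-covers : ∀ {x y} → Q x → Q y → R x y → d ∣ x + y → C x ⊎ C y) where

  private
    finalPair : ∀ {x y} → R x y → Q x → Q y → count C? (x ∷ y ∷ []) ≡ 0 → ¬ d ∣ x + y
    finalPair {x} {y} rxy qx qy none d∣x+y
      with C-covers qx qy rxy d∣x+y | count≡0⇒All¬ C? (x ∷ y ∷ []) none
    ... | inj₁ cx | ¬cx ∷ _      = ¬cx cx
    ... | inj₂ cy | _ ∷ ¬cy ∷ [] = ¬cy cy

  -- B's strategy: cross out a number of C whenever one is left on the board.
  count≤turnsLeftForB⇒BWins : ∀ pl k (v : Vec ℕ (k + 2)) → AllPairs R v → All Q v →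
                        count C? v ≤ turnsLeftForB pl k → BWins d pl k v
  count≤turnsLeftForB⇒BWins A zero (x ∷ y ∷ []) ((rxy ∷ []) ∷ _) (qx ∷ qy ∷ []) none =
    finalPair rxy qx qy (n≤0⇒n≡0 none)
  count≤turnsLeftForB⇒BWins B zero (x ∷ y ∷ []) ((rxy ∷ []) ∷ _) (qx ∷ qy ∷ []) none =
    finalPair rxy qx qy (n≤0⇒n≡0 none)
  count≤turnsLeftForB⇒BWins A (suc k) v rv qv few i =
    count≤turnsLeftForB⇒BWins B k (removeAt v i) (AllPairs-removeAt v i rv) (All-removeAt v i qv)
      (≤-trans (count-removeAt-≤ C? v i) few)
  count≤turnsLeftForB⇒BWins B (suc k) v rv qv few with ∃removeAt-count≡pred C? v
  ... | i , eq = i , count≤turnsLeftForB⇒BWins A k (removeAt v i) (AllPairs-removeAt v i rv) (All-removeAt v i qv)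
                       (subst (_≤ ⌊ k /2⌋) (sym eq) (pred-mono-≤ few))

2*n≡n+n : ∀ n → 2 * n ≡ n + n
2*n≡n+n n = cong (n +_) (+-identityʳ n)

m+m≤n⇒m≤⌊n/2⌋ : ∀ {m n} → m + m ≤ n → m ≤ ⌊ n /2⌋
m+m≤n⇒m≤⌊n/2⌋ {m} le = subst (_≤ _) (sym (n≡⌊n+n/2⌋ m)) (⌊n/2⌋-mono le)

m≤n+n⇒⌊m/2⌋≤n : ∀ {m n} → m ≤ n + n → ⌊ m /2⌋ ≤ n
m≤n+n⇒⌊m/2⌋≤n {n = n} le = subst (_ ≤_) (sym (n≡⌊n+n/2⌋ n)) (⌊n/2⌋-mono le)

⌊n/2⌋+⌊n/2⌋≤n : ∀ n → ⌊ n /2⌋ + ⌊ n /2⌋ ≤ n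
⌊n/2⌋+⌊n/2⌋≤n n = ≤-trans (+-monoʳ-≤ ⌊ n /2⌋ (⌊n/2⌋≤⌈n/2⌉ n)) (≤-reflexive (⌊n/2⌋+⌈n/2⌉≡n n))

m<n+n⇒⌊m/2⌋<n : ∀ {m n} → m < n + n → ⌊ m /2⌋ < n
m<n+n⇒⌊m/2⌋<n {m} lt = ≰⇒> λ n≤h → <⇒≱ lt (≤-trans (+-mono-≤ n≤h n≤h) (⌊n/2⌋+⌊n/2⌋≤n m))

m+m<n+n⇒m<n : ∀ {m n} → m + m < n + n → m < n
m+m<n+n⇒m<n lt = ≰⇒> λ n≤m → <⇒≱ lt (+-mono-≤ n≤m n≤m)

module Blockers (n d : ℕ) where

  InBoard : Pred ℕ 0ℓ
  InBoard x = 1 ≤ x × x ≤ n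

  LowBlocker : Pred ℕ 0ℓ
  LowBlocker x = (d < x + x × x < d) ⊎ (x + x ≡ d × x + d ≤ n)

  HighBlocker : Pred ℕ 0ℓ
  HighBlocker x = 3 * d < x + x

  Blocker : Pred ℕ 0ℓ
  Blocker = LowBlocker ∪ HighBlocker

  lowBlocker? : Decidable LowBlocker
  lowBlocker? x = ((d <? x + x) ×-dec (x <? d)) ⊎-dec ((x + x ≟ d) ×-dec (x + d ≤? n))

  highBlocker? : Decidable HighBlocker
  highBlocker? x = 3 * d <? x + x

  blocker? : Decidable Blocker
  blocker? = lowBlocker? ∪? highBlocker?

  private
    h c : ℕ
    h = ⌊ d /2⌋
    c = ⌈ d /2⌉

  sum≡d⇒lowBlocker : ∀ {x y} → 1 ≤ x → x < y → x + y ≡ d → LowBlocker y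
  sum≡d⇒lowBlocker {x} {y} 1≤x x<y x+y≡d =
    inj₁ (subst (_< y + y) x+y≡d (+-monoˡ-< y x<y) , subst (y <_) x+y≡d (m<n+m y 1≤x))

  sum≡2d⇒blocker : ∀ {x y} → x < y → y ≤ n → x + y ≡ 2 * d → Blocker x ⊎ Blocker y
  sum≡2d⇒blocker {x} {y} x<y y≤n x+y≡2d with <-cmp d (x + x)
  ... | tri< d<2x _ _ = inj₁ (inj₁ (inj₁ (d<2x , x<d)))
    where
    x<d : x < d
    x<d = ≰⇒> λ d≤x → <⇒≢ (+-mono-≤-< d≤x (≤-<-trans d≤x x<y)) (sym (trans x+y≡2d (2*n≡n+n d)))
  ... | tri≈ _ d≡2x _ = inj₁ (inj₁ (inj₂ (sym d≡2x , subst (_≤ n) y≡x+d y≤n)))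
    where
    open ≡-Reasoning
    y≡x+d : y ≡ x + d
    y≡x+d = +-cancelˡ-≡ x y (x + d) (begin
      x + y       ≡⟨ trans x+y≡2d (2*n≡n+n d) ⟩
      d + d       ≡⟨ cong (_+ d) d≡2x ⟩
      (x + x) + d ≡⟨ +-assoc x x d ⟩
      x + (x + d) ∎)
  ... | tri> _ _ 2x<d = inj₂ (inj₂ (+-cancelˡ-< d (3 * d) (y + y) (begin-strict
      d + 3 * d           ≡⟨ four d ⟩
      2 * d + 2 * d       ≡⟨ cong₂ _+_ (sym x+y≡2d) (sym x+y≡2d) ⟩
      (x + y) + (x + y)   ≡⟨ double-sum x y ⟩
      (x + x) + (y + y)   <⟨ +-monoˡ-< (y + y) 2x<d ⟩
      d + (y + y)         ∎)))
    where
    open ≤-Reasoning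
    four : ∀ d → d + 3 * d ≡ 2 * d + 2 * d
    four = solve-∀
    double-sum : ∀ x y → (x + y) + (x + y) ≡ (x + x) + (y + y)
    double-sum = solve-∀

  sum≡3d⇒highBlocker : ∀ {x y} → x < y → x + y ≡ 3 * d → HighBlocker y
  sum≡3d⇒highBlocker {x} {y} x<y x+y≡3d = subst (_< y + y) x+y≡3d (+-monoˡ-< y x<y)

  sum<4d : n + 3 ≤ 2 * d → ∀ {x y} → x < y → y ≤ n → x + y < 4 * d
  sum<4d n+3≤2d {x} {y} x<y y≤n = begin-strict
    x + y             <⟨ +-mono-<-≤ (<-≤-trans x<y y≤n) y≤n ⟩
    n + n             ≤⟨ +-mono-≤ (m≤m+n n 3) (m≤m+n n 3) ⟩
    (n + 3) + (n + 3) ≤⟨ +-mono-≤ n+3≤2d n+3≤2d ⟩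
    2 * d + 2 * d     ≡⟨ four d ⟩
    4 * d             ∎
    where
    open ≤-Reasoning
    four : ∀ d → 2 * d + 2 * d ≡ 4 * d
    four = solve-∀

  blockers-cover : n + 3 ≤ 2 * d → ∀ {x y} → InBoard x → InBoard y → x < y →
                   d ∣ x + y → Blocker x ⊎ Blocker y
  blockers-cover _ (s≤s _ , _) _ _ (divides zero ())
  blockers-cover _ (1≤x , _) _ x<y (divides 1 eq) =
    inj₂ (inj₁ (sum≡d⇒lowBlocker 1≤x x<y (trans eq (*-identityˡ d))))
  blockers-cover _ _ (_ , y≤n) x<y (divides 2 eq) = sum≡2d⇒blocker x<y y≤n eq
  blockers-cover _ _ _ x<y (divides 3 eq) = inj₂ (inj₂ (sum≡3d⇒highBlocker x<y eq))
  blockers-cover n+3≤2d _ (_ , y≤n) x<y (divides (suc (suc (suc (suc k)))) eq) =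
    ⊥-elim (<⇒≱ (sum<4d n+3≤2d x<y y≤n) (subst (4 * d ≤_) (sym eq) (*-monoˡ-≤ d (m≤m+n 4 k))))

  lowBlocker⇒⌈d/2⌉≤x<d : ∀ {x} → 1 ≤ x → LowBlocker x → c ≤ x × x < d
  lowBlocker⇒⌈d/2⌉≤x<d     _   (inj₁ (d<2x , x<d)) = m≤n+n⇒⌊m/2⌋≤n d<2x , x<d
  lowBlocker⇒⌈d/2⌉≤x<d {x} 1≤x (inj₂ (2x≡d , _))  =
    ≤-reflexive (trans (cong ⌈_/2⌉ (sym 2x≡d)) (sym (n≡⌈n+n/2⌉ x))) , subst (x <_) 2x≡d (m<n+m x 1≤x)

  highBlocker⇒d+⌊d/2⌋<x : ∀ {x} → HighBlocker x → d + h < x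
  highBlocker⇒d+⌊d/2⌋<x {x} 3d<2x = m+m<n+n⇒m<n (begin-strict
    (d + h) + (d + h) ≡⟨ double-sum d h ⟩
    (d + d) + (h + h) ≤⟨ +-monoʳ-≤ (d + d) (⌊n/2⌋+⌊n/2⌋≤n d) ⟩
    (d + d) + d       ≡⟨ three d ⟩
    3 * d             <⟨ 3d<2x ⟩
    x + x             ∎)
    where
    open ≤-Reasoning
    double-sum : ∀ x y → (x + y) + (x + y) ≡ (x + x) + (y + y)
    double-sum = solve-∀
    three : ∀ d → (d + d) + d ≡ 3 * d
    three = solve-∀

  -- n < d + ⌊d/2⌋ says that 3d/2 is off the board.
  lowBlocker⇒⌊d/2⌋<x<d : n < d + h → ∀ {x} → LowBlocker x → h < x × x < d
  lowBlocker⇒⌊d/2⌋<x<d _    (inj₁ (d<2x , x<d))  = m<n+n⇒⌊m/2⌋<n d<2x , x<d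
  lowBlocker⇒⌊d/2⌋<x<d n<d+h {x} (inj₂ (2x≡d , x+d≤n)) = ⊥-elim (<⇒≱ n<d+h (begin
    d + h ≡⟨ cong (d +_) (trans (cong ⌊_/2⌋ (sym 2x≡d)) (sym (n≡⌊n+n/2⌋ x))) ⟩
    d + x ≡⟨ +-comm d x ⟩
    x + d ≤⟨ x+d≤n ⟩
    n     ∎))
    where open ≤-Reasoning

  ¬highBlocker : n < d + h → ∀ {x} → x ≤ n → ¬ HighBlocker x
  ¬highBlocker n<d+h x≤n 3d<2x = <⇒≱ (<-trans n<d+h (highBlocker⇒d+⌊d/2⌋<x 3d<2x)) x≤n

  count-blockers≤n∸d : d + h ≤ n → ∀ {len} (v : Vec ℕ len) → AllPairs _<_ v → All InBoard v →
                       count blocker? v ≤ n ∸ d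
  count-blockers≤n∸d d+h≤n v sorted onBoard = begin
    count blocker? v                                   ≤⟨ count-∪-≤ lowBlocker? highBlocker? v ⟩
    count lowBlocker? v + count highBlocker? v         ≤⟨ +-mono-≤ low high ⟩
    (d ∸ c) + (n ∸ (d + h))                            ≡⟨ cong₂ _+_ d∸c≡h (sym (∸-+-assoc n d h)) ⟩
    h + (n ∸ d ∸ h)                                    ≡⟨ m+[n∸m]≡n (m+n≤o⇒m≤o∸n h (subst (_≤ n) (+-comm d h) d+h≤n)) ⟩
    n ∸ d                                              ∎
    where
    open ≤-Reasoning
    low : count lowBlocker? v ≤ d ∸ c
    low = count≤hi∸lo lowBlocker? v sorted (All.map (λ (1≤x , _) → lowBlocker⇒⌈d/2⌉≤x<d 1≤x) onBoard)
    high : count highBlocker? v ≤ suc n ∸ suc (d + h)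
    high = count≤hi∸lo highBlocker? v sorted
             (All.map (λ (_ , x≤n) 3d<2x → highBlocker⇒d+⌊d/2⌋<x 3d<2x , s≤s x≤n) onBoard)
    d∸c≡h : d ∸ c ≡ h
    d∸c≡h = trans (cong (_∸ c) (sym (⌊n/2⌋+⌈n/2⌉≡n d))) (m+n∸n≡m h c)

  count-blockers≤pred⌈d/2⌉ : n < d + h → ∀ {len} (v : Vec ℕ len) → AllPairs _<_ v → All InBoard v →
                             count blocker? v ≤ pred c
  count-blockers≤pred⌈d/2⌉ n<d+h v sorted onBoard = begin
    count blocker? v                           ≤⟨ count-∪-≤ lowBlocker? highBlocker? v ⟩
    count lowBlocker? v + count highBlocker? v ≤⟨ +-mono-≤ low (≤-reflexive high) ⟩
    (d ∸ suc h) + 0                            ≡⟨ +-identityʳ _ ⟩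
    d ∸ suc h                                  ≡⟨ sym (pred[m∸n]≡m∸[1+n] d h) ⟩
    pred (d ∸ h)                               ≡⟨ cong pred d∸h≡c ⟩
    pred c                                     ∎
    where
    open ≤-Reasoning
    low : count lowBlocker? v ≤ d ∸ suc h
    low = count≤hi∸lo lowBlocker? v sorted (All.universal (λ _ → lowBlocker⇒⌊d/2⌋<x<d n<d+h) v)
    high : count highBlocker? v ≡ 0
    high = All¬⇒count≡0 highBlocker? v (All.map (λ (_ , x≤n) → ¬highBlocker n<d+h x≤n) onBoard)
    d∸h≡c : d ∸ h ≡ c
    d∸h≡c = trans (cong (_∸ h) (sym (⌊n/2⌋+⌈n/2⌉≡n d))) (m+n∸m≡n h c)

  n∸d≤⌊[n∸2]/2⌋ : n + 3 ≤ 2 * d → d ≤ n → n ∸ d ≤ ⌊ (n ∸ 2) /2⌋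
  n∸d≤⌊[n∸2]/2⌋ n+3≤2d d≤n = m+m≤n⇒m≤⌊n/2⌋ (m+n≤o⇒m≤o∸n (t + t) (begin
    (t + t) + 2 ≡⟨ +-assoc t t 2 ⟩
    t + (t + 2) ≤⟨ +-monoʳ-≤ t (≤-trans (+-monoʳ-≤ t (n≤1+n 2)) t+3≤d) ⟩
    t + d       ≡⟨ m∸n+n≡m d≤n ⟩
    n           ∎))
    where
    open ≤-Reasoning
    t : ℕ
    t = n ∸ d
    t+3≤d : t + 3 ≤ d
    t+3≤d = +-cancelʳ-≤ d (t + 3) d (begin
      (t + 3) + d ≡⟨ +-comm-3 t d ⟩
      (t + d) + 3 ≡⟨ cong (_+ 3) (m∸n+n≡m d≤n) ⟩
      n + 3       ≤⟨ n+3≤2d ⟩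
      2 * d       ≡⟨ 2*n≡n+n d ⟩
      d + d       ∎)
      where
      +-comm-3 : ∀ t d → (t + 3) + d ≡ (t + d) + 3
      +-comm-3 = solve-∀

  count-blockers≤ : n + 3 ≤ 2 * d → d ≤ suc (n ∸ 2) → ∀ {len} (v : Vec ℕ len) →
                    AllPairs _<_ v → All InBoard v → count blocker? v ≤ ⌊ (n ∸ 2) /2⌋
  count-blockers≤ n+3≤2d d≤1+[n∸2] v sorted onBoard with d + h ≤? n
  ... | yes d+h≤n = ≤-trans (count-blockers≤n∸d d+h≤n v sorted onBoard)
                            (n∸d≤⌊[n∸2]/2⌋ n+3≤2d (m+n≤o⇒m≤o d d+h≤n))
  ... | no  d+h≰n = ≤-trans (count-blockers≤pred⌈d/2⌉ (≰⇒> d+h≰n) v sorted onBoard)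
                            (pred-mono-≤ (⌈n/2⌉-mono d≤1+[n∸2]))

theorem3p2p1 : (n : ℕ) → 5 ≤ n → n % 2 ≡ 1 →
    (d : ℕ) → n + 3 ≤ 2 * d → d ≤ n ∸ 1 →
    BHasWinningStrategy n d
theorem3p2p1 (suc zero) (s≤s ()) _
theorem3p2p1 (suc (suc m)) _ _ d n+3≤2d d≤n∸1 =
  count≤turnsLeftForB⇒BWins d blocker? (blockers-cover n+3≤2d) A m board sorted onBoard
    (count-blockers≤ n+3≤2d d≤n∸1 board sorted onBoard)
  where
  open Blockers (suc (suc m)) d
  board : Vec ℕ (m + 2)
  board = initialBoard (m + 2)
  sorted : AllPairs _<_ board
  sorted = AllPairs-tabulate-< s≤s
  onBoard : All InBoard board
  onBoard = Allₚ.tabulate⁺ λ i → s≤s z≤n , ≤-trans (toℕ<n i) (≤-reflexive (+-comm m 2))
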